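{- Let $F_1(t,x)=x^3+48x^2+(336-1296t^2)x-10368t^2+640$ and let $c\in\mathbb Q$, $c\neq0$. Then $F_1(c,x)$ has a root in $\mathbb Q$ if and only if there exists $v\in\mathbb Q$ with $v\neq\pm1$ such that \[c=\frac{v^3-9v}{9(1-v^2)}.\] -}

module Defs where

open import Data.Nat using (ℕ)
open import Data.Integer using (+_)
open import Data.Rational using (ℚ; _+_; _*_; _-_; -_; _÷_; NonZero; 1ℚ; _/_)

#_ : ℕ → ℚ
# n = (+ n) / 1

infix 10 #_

F₁ : ℚ → ℚ → ℚ
F₁ t x = x * x * x + # 48 * (x * x) + (# 336 - # 1296 * (t * t)) * x
         - # 10368 * (t * t) + # 640

paramC : (v : ℚ) → .{{_ : NonZero (# 9 * (1ℚ - v * v))}} → ℚ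
paramC v = (v * v * v - # 9 * v) ÷ (# 9 * (1ℚ - v * v))

{-# OPTIONS --safe #-}
module Submission where

-- F₁(t, x) = (x + 4)²(x + 40) − (36t)²(x + 8), so the cubic curve F₁ = 0 has a node at
-- (t, x) = (0, −4) and is rational. The line 36t = v(x + 4) through the node meets the curve
-- in exactly one further point, where (v² − 1)(x + 8) = 32 and hence t = (v³ − 9v)/(9(1 − v²)).
-- Conversely, for t ≠ 0 a root x avoids the node, so it lies on the line of slope v = 36t/(x + 4).

open import Defs
open import Algebra.Apartness.Properties.HeytingCommutativeRing using (x#0y#0→xy#0)
open import Algebra.Properties.Group using (x∙y⁻¹≈ε⇒x≈y)
open import Data.Product using (Σ; ∃; ∃-syntax; _×_; _,_)
open import Data.Rational using (ℚ; 0ℚ; 1ℚ; -_; _+_; _-_; _*_; 1/_; _÷_; NonZero; ≢-nonZero)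
open import Data.Rational.Properties
  using (*-assoc; *-identityʳ; *-inverseˡ; *-inverseʳ; *-zeroˡ; +-0-group; heytingCommutativeRing)
open import Data.Rational.Solver using (module +-*-Solver)
open import Function.Bundles using (_⇔_; mk⇔; Equivalence)
open import Relation.Binary.PropositionalEquality
  using (_≡_; _≢_; refl; sym; trans; cong; module ≡-Reasoning)

open +-*-Solver
open ≡-Reasoning

÷-*-cancel : ∀ p q .{{_ : NonZero q}} → p ÷ q * q ≡ p
÷-*-cancel p q = begin
  p * 1/ q * q    ≡⟨ *-assoc p (1/ q) q ⟩
  p * (1/ q * q)  ≡⟨ cong (p *_) (*-inverseˡ q) ⟩
  p * 1ℚ          ≡⟨ *-identityʳ p ⟩
  p               ∎

*-÷-cancel : ∀ p q .{{_ : NonZero q}} → p * q ÷ q ≡ p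
*-÷-cancel p q = begin
  p * q * 1/ q    ≡⟨ *-assoc p q (1/ q) ⟩
  p * (q * 1/ q)  ≡⟨ cong (p *_) (*-inverseʳ q) ⟩
  p * 1ℚ          ≡⟨ *-identityʳ p ⟩
  p               ∎

*-cancelʳ-≡ : ∀ {p q} r .{{_ : NonZero r}} → p * r ≡ q * r → p ≡ q
*-cancelʳ-≡ {p} {q} r eq = begin
  p          ≡⟨ sym (*-÷-cancel p r) ⟩
  p * r ÷ r  ≡⟨ cong (_÷ r) eq ⟩
  q * r ÷ r  ≡⟨ *-÷-cancel q r ⟩
  q          ∎

*≡⇒≡÷ : ∀ {p r} q .{{_ : NonZero q}} → p * q ≡ r → p ≡ r ÷ q
*≡⇒≡÷ {r = r} q eq = *-cancelʳ-≡ q (trans eq (sym (÷-*-cancel r q)))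

*-preserves-≢0 : ∀ {p q} → p ≢ 0ℚ → q ≢ 0ℚ → p * q ≢ 0ℚ
*-preserves-≢0 = x#0y#0→xy#0 heytingCommutativeRing

den : ℚ → ℚ
den v = # 9 * (1ℚ - v * v)

num : ℚ → ℚ
num v = v * v * v - # 9 * v

F₁-factorisation : ∀ c x →
  F₁ c x ≡ (x + # 4) * (x + # 4) * (x + # 40) - (# 36 * c) * (# 36 * c) * (x + # 8)
F₁-factorisation = solve 2 (λ c x →
  x :* x :* x :+ con (# 48) :* (x :* x) :+ (con (# 336) :- con (# 1296) :* (c :* c)) :* x
    :- con (# 10368) :* (c :* c) :+ con (# 640)
  := (x :+ con (# 4)) :* (x :+ con (# 4)) :* (x :+ con (# 40))
    :- (con (# 36) :* c) :* (con (# 36) :* c) :* (x :+ con (# 8))) refl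

F₁-at-node : ∀ c → F₁ c (- # 4) ≡ - # 5184 * (c * c)
F₁-at-node = solve 1 (λ c →
  let x = :- con (# 4) in
  x :* x :* x :+ con (# 48) :* (x :* x) :+ (con (# 336) :- con (# 1296) :* (c :* c)) :* x
    :- con (# 10368) :* (c :* c) :+ con (# 640)
  := :- con (# 5184) :* (c :* c)) refl

F₁-root-off-node : ∀ {c} x → c ≢ 0ℚ → F₁ c x ≡ 0ℚ → x + # 4 ≢ 0ℚ
F₁-root-off-node {c} x c≢0 root x+4≡0 =
  *-preserves-≢0 { - # 5184} (λ ()) (*-preserves-≢0 c≢0 c≢0) (begin
  - # 5184 * (c * c)  ≡⟨ sym (F₁-at-node c) ⟩
  -- x + # 4 is x - (- # 4) by computation on the literal.
  F₁ c (- # 4)        ≡⟨ cong (F₁ c) (sym (x∙y⁻¹≈ε⇒x≈y +-0-group x (- # 4) x+4≡0)) ⟩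
  F₁ c x              ≡⟨ root ⟩
  0ℚ                  ∎)

F₁-on-line : ∀ c x v → v * (x + # 4) ≡ # 36 * c →
  F₁ c x ≡ (# 32 - (v * v - 1ℚ) * (x + # 8)) * ((x + # 4) * (x + # 4))
F₁-on-line c x v line = begin
  F₁ c x
    ≡⟨ F₁-factorisation c x ⟩
  (x + # 4) * (x + # 4) * (x + # 40) - (# 36 * c) * (# 36 * c) * (x + # 8)
    ≡⟨ cong (λ t → (x + # 4) * (x + # 4) * (x + # 40) - t * t * (x + # 8)) (sym line) ⟩
  (x + # 4) * (x + # 4) * (x + # 40) - (v * (x + # 4)) * (v * (x + # 4)) * (x + # 8)
    ≡⟨ regroup ⟩
  (# 32 - (v * v - 1ℚ) * (x + # 8)) * ((x + # 4) * (x + # 4))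
    ∎
  where
  regroup :
    (x + # 4) * (x + # 4) * (x + # 40) - (v * (x + # 4)) * (v * (x + # 4)) * (x + # 8)
      ≡ (# 32 - (v * v - 1ℚ) * (x + # 8)) * ((x + # 4) * (x + # 4))
  regroup = solve 2 (λ x v → let e = x :+ con (# 4) in
    e :* e :* (x :+ con (# 40)) :- (v :* e) :* (v :* e) :* (x :+ con (# 8))
    := (con (# 32) :- (v :* v :- con 1ℚ) :* (x :+ con (# 8))) :* (e :* e)) refl x v

on-line-root⇒residual : ∀ c x v → x + # 4 ≢ 0ℚ → v * (x + # 4) ≡ # 36 * c → F₁ c x ≡ 0ℚ →
  (v * v - 1ℚ) * (x + # 8) ≡ # 32
on-line-root⇒residual c x v x+4≢0 line root = sym (x∙y⁻¹≈ε⇒x≈y +-0-group (# 32) _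
  (*-cancelʳ-≡ ((x + # 4) * (x + # 4)) {{≢-nonZero (*-preserves-≢0 x+4≢0 x+4≢0)}} (begin
    (# 32 - (v * v - 1ℚ) * (x + # 8)) * ((x + # 4) * (x + # 4)) ≡⟨ F₁-on-line c x v line ⟨
    F₁ c x                                                     ≡⟨ root ⟩
    0ℚ                                                         ≡⟨ *-zeroˡ ((x + # 4) * (x + # 4)) ⟨
    0ℚ * ((x + # 4) * (x + # 4))                               ∎)))

v*v-1≢0 : ∀ x v → (v * v - 1ℚ) * (x + # 8) ≡ # 32 → v * v - 1ℚ ≢ 0ℚ
v*v-1≢0 x v residual w≡0 = 32≢0 (begin
  # 32                      ≡⟨ sym residual ⟩
  (v * v - 1ℚ) * (x + # 8)  ≡⟨ cong (_* (x + # 8)) w≡0 ⟩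
  0ℚ * (x + # 8)            ≡⟨ *-zeroˡ (x + # 8) ⟩
  0ℚ                        ∎)
  where
  32≢0 : # 32 ≢ 0ℚ
  32≢0 ()

residual⇒den≢0 : ∀ x v → (v * v - 1ℚ) * (x + # 8) ≡ # 32 → den v ≢ 0ℚ
residual⇒den≢0 x v residual den≡0 =
  *-preserves-≢0 { q = - # 9 } (v*v-1≢0 x v residual) (λ ()) (trans (sym den-slope) den≡0)
  where
  den-slope : den v ≡ (v * v - 1ℚ) * - # 9
  den-slope = solve 1 (λ v →
    con (# 9) :* (con 1ℚ :- v :* v) := (v :* v :- con 1ℚ) :* (:- con (# 9))) refl v

line⇔param : ∀ c x v → (v * v - 1ℚ) * (x + # 8) ≡ # 32 →
  v * (x + # 4) ≡ # 36 * c ⇔ c * den v ≡ num v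
line⇔param c x v residual = mk⇔
  (λ line → *-cancelʳ-≡ (- # 4) (begin
    c * den v * - # 4   ≡⟨ scaled ⟨
    # 36 * c * w        ≡⟨ cong (_* w) (sym line) ⟩
    v * (x + # 4) * w   ≡⟨ on-residual ⟩
    num v * - # 4       ∎))
  (λ param → *-cancelʳ-≡ w {{≢-nonZero (v*v-1≢0 x v residual)}} (begin
    v * (x + # 4) * w   ≡⟨ on-residual ⟩
    num v * - # 4       ≡⟨ cong (_* - # 4) (sym param) ⟩
    c * den v * - # 4   ≡⟨ sym scaled ⟩
    # 36 * c * w        ∎))
  where
  w : ℚ
  w = v * v - 1ℚ
  scaled : # 36 * c * w ≡ c * den v * - # 4
  scaled = solve 2 (λ c v →
    con (# 36) :* c :* (v :* v :- con 1ℚ)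
    := c :* (con (# 9) :* (con 1ℚ :- v :* v)) :* (:- con (# 4))) refl c v
  expand : v * (x + # 4) * w ≡ v * (w * (x + # 8)) - # 4 * (v * w)
  expand = solve 2 (λ x v →
    v :* (x :+ con (# 4)) :* (v :* v :- con 1ℚ)
    := v :* ((v :* v :- con 1ℚ) :* (x :+ con (# 8))) :- con (# 4) :* (v :* (v :* v :- con 1ℚ))) refl x v
  collect : v * # 32 - # 4 * (v * w) ≡ num v * - # 4
  collect = solve 1 (λ v →
    v :* con (# 32) :- con (# 4) :* (v :* (v :* v :- con 1ℚ))
    := (v :* v :* v :- con (# 9) :* v) :* (:- con (# 4))) refl v
  on-residual : v * (x + # 4) * w ≡ num v * - # 4
  on-residual = begin
    v * (x + # 4) * w                    ≡⟨ expand ⟩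
    v * (w * (x + # 8)) - # 4 * (v * w)  ≡⟨ cong (λ t → v * t - # 4 * (v * w)) residual ⟩
    v * # 32 - # 4 * (v * w)             ≡⟨ collect ⟩
    num v * - # 4                        ∎

-- The root x + 8 = 32 / (v² − 1) written over den v = −9 (v² − 1), whose
-- nonvanishing is what the statement provides.
param⇒root : ∀ {c} v .{{_ : NonZero (den v)}} → c ≡ paramC v →
  F₁ c (- # 288 ÷ den v - # 8) ≡ 0ℚ
param⇒root {c} v c≡paramC = begin
  F₁ c x                                              ≡⟨ F₁-on-line c x v line ⟩
  (# 32 - (v * v - 1ℚ) * (x + # 8)) * ((x + # 4) * (x + # 4))
    ≡⟨ cong (λ t → (# 32 - t) * ((x + # 4) * (x + # 4))) residual ⟩
  (# 32 - # 32) * ((x + # 4) * (x + # 4))             ≡⟨ *-zeroˡ ((x + # 4) * (x + # 4)) ⟩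
  0ℚ                                                  ∎
  where
  x : ℚ
  x = - # 288 ÷ den v - # 8
  scaled : (v * v - 1ℚ) * (x + # 8) * - # 9 ≡ (x + # 8) * den v
  scaled = solve 2 (λ v y →
    (v :* v :- con 1ℚ) :* y :* (:- con (# 9)) := y :* (con (# 9) :* (con 1ℚ :- v :* v)))
    refl v (x + # 8)
  sub-add : ∀ a → a - # 8 + # 8 ≡ a
  sub-add = solve 1 (λ a → a :- con (# 8) :+ con (# 8) := a) refl
  residual : (v * v - 1ℚ) * (x + # 8) ≡ # 32
  residual = *-cancelʳ-≡ (- # 9) (begin
    (v * v - 1ℚ) * (x + # 8) * - # 9  ≡⟨ scaled ⟩
    (x + # 8) * den v                 ≡⟨ cong (_* den v) (sub-add (- # 288 ÷ den v)) ⟩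
    - # 288 ÷ den v * den v           ≡⟨ ÷-*-cancel (- # 288) (den v) ⟩
    # 32 * - # 9                      ∎)
  line : v * (x + # 4) ≡ # 36 * c
  line = Equivalence.from (line⇔param c x v residual) (begin
    c * den v                ≡⟨ cong (_* den v) c≡paramC ⟩
    num v ÷ den v * den v    ≡⟨ ÷-*-cancel (num v) (den v) ⟩
    num v                    ∎)

root⇒param : ∀ {c} x → c ≢ 0ℚ → F₁ c x ≡ 0ℚ →
  ∃[ v ] (v ≢ 1ℚ) × (v ≢ - 1ℚ) × Σ (NonZero (den v)) (λ nz → c ≡ paramC v {{nz}})
root⇒param {c} x c≢0 root = v , v≢1 , v≢-1 , den-nonZero , c≡paramC
  where
  x+4≢0 : x + # 4 ≢ 0ℚ
  x+4≢0 = F₁-root-off-node x c≢0 root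
  instance
    x+4-nonZero : NonZero (x + # 4)
    x+4-nonZero = ≢-nonZero x+4≢0
  v : ℚ
  v = # 36 * c ÷ (x + # 4)
  line : v * (x + # 4) ≡ # 36 * c
  line = ÷-*-cancel (# 36 * c) (x + # 4)
  residual : (v * v - 1ℚ) * (x + # 8) ≡ # 32
  residual = on-line-root⇒residual c x v x+4≢0 line root
  v≢1 : v ≢ 1ℚ
  v≢1 v≡1 = v*v-1≢0 x v residual (cong (λ t → t * t - 1ℚ) v≡1)
  v≢-1 : v ≢ - 1ℚ
  v≢-1 v≡-1 = v*v-1≢0 x v residual (cong (λ t → t * t - 1ℚ) v≡-1)
  den-nonZero : NonZero (den v)
  den-nonZero = ≢-nonZero (residual⇒den≢0 x v residual)
  c≡paramC : c ≡ paramC v {{den-nonZero}}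
  c≡paramC = *≡⇒≡÷ (den v) {{den-nonZero}} (Equivalence.to (line⇔param c x v residual) line)

lemma4p7 : (c : ℚ) → c ≢ 0ℚ →
    (∃[ x ] F₁ c x ≡ 0ℚ) ⇔
    (∃[ v ] (v ≢ 1ℚ) × (v ≢ - 1ℚ) × Σ (NonZero (# 9 * (1ℚ - v * v))) (λ nz → c ≡ paramC v {{nz}}))
lemma4p7 c c≢0 = mk⇔
  (λ { (x , root) → root⇒param x c≢0 root })
  (λ { (v , _ , _ , nz , c≡paramC) → (- # 288 ÷ den v) {{nz}} - # 8 , param⇒root v {{nz}} c≡paramC })
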